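{- Let $(X,\sigma,\tau)$ be a $2$-reductive solution. Then the equivalence relations $\sim$ and $\backsim$ on $X$ are congruences of $(X,\sigma,\tau)$.
   Context: A solution is a triple $(X,\sigma,\tau)$ with bijections $\sigma_x,\tau_y$ of a non-empty set $X$ such that $r(x,y)=(\sigma_x(y),\tau_y(x))$ is a bijection of $X^2$ satisfying $(\mathrm{id}\times r)(r\times\mathrm{id})(\mathrm{id}\times r)=(r\times\mathrm{id})(\mathrm{id}\times r)(r\times\mathrm{id})$. It is $2$-reductive if for all $x,y$: $\sigma_{\sigma_x(y)}=\sigma_y$, $\tau_{\tau_x(y)}=\tau_y$, $\sigma_{\tau_x(y)}=\sigma_y$, $\tau_{\sigma_x(y)}=\tau_y$. Define $x\sim y$ iff $\sigma_x=\sigma_y$, and $x\backsim y$ iff $\tau_x=\tau_y$. A congruence of the solution is an equivalence relation $\asymp$ on $X$ such that $x_1\asymp x_2$ and $y_1\asymp y_2$ imply $\sigma^{\varepsilon}_{x_1}(y_1)\asymp\sigma^{\varepsilon}_{x_2}(y_2)$ and $\tau^{\varepsilon}_{x_1}(y_1)\asymp\tau^{\varepsilon}_{x_2}(y_2)$ for $\varepsilon\in\{1,-1\}$. -}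

module Defs where

open import Level using (Level; suc; _⊔_)
open import Data.Product using (_×_; _,_; proj₁; proj₂)
open import Function.Bundles using (_↔_; Inverse)
open import Relation.Binary.PropositionalEquality using (_≡_)
open import Relation.Binary.Structures using (IsEquivalence)
open import Function.Definitions using (Bijective)

record Solution (ℓ : Level) : Set (suc ℓ) where
  field
    X        : Set ℓ
    inhabited : X
    σ        : X → (X ↔ X)
    τ        : X → (X ↔ X)

  σ[_] : X → X → X
  σ[ x ] = Inverse.to (σ x)

  σ⁻¹[_] : X → X → X
  σ⁻¹[ x ] = Inverse.from (σ x)

  τ[_] : X → X → X
  τ[ x ] = Inverse.to (τ x)

  τ⁻¹[_] : X → X → X
  τ⁻¹[ x ] = Inverse.from (τ x)

  r : X × X → X × X
  r (x , y) = (σ[ x ] y , τ[ y ] x)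

  r₁₂ : X × X × X → X × X × X
  r₁₂ (x , y , z) = let (a , b) = r (x , y) in (a , b , z)

  r₂₃ : X × X × X → X × X × X
  r₂₃ (x , y , z) = let (b , c) = r (y , z) in (x , b , c)

  field
    r-bijective : Bijective _≡_ _≡_ r
    braid : ∀ t → r₂₃ (r₁₂ (r₂₃ t)) ≡ r₁₂ (r₂₃ (r₁₂ t))

module _ {ℓ : Level} (S : Solution ℓ) where
  open Solution S

  Is2Reductive : Set ℓ
  Is2Reductive =
    (∀ x y z → σ[ σ[ x ] y ] z ≡ σ[ y ] z) ×
    (∀ x y z → τ[ τ[ x ] y ] z ≡ τ[ y ] z) ×
    (∀ x y z → σ[ τ[ x ] y ] z ≡ σ[ y ] z) ×
    (∀ x y z → τ[ σ[ x ] y ] z ≡ τ[ y ] z)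

  _∼_ : X → X → Set ℓ
  x ∼ y = ∀ z → σ[ x ] z ≡ σ[ y ] z

  _∽_ : X → X → Set ℓ
  x ∽ y = ∀ z → τ[ x ] z ≡ τ[ y ] z

  record IsCongruence (_≍_ : X → X → Set ℓ) : Set ℓ where
    field
      isEquivalence : IsEquivalence _≍_
      σ-cong  : ∀ {x₁ x₂ y₁ y₂} → x₁ ≍ x₂ → y₁ ≍ y₂ → σ[ x₁ ] y₁ ≍ σ[ x₂ ] y₂
      σ⁻¹-cong : ∀ {x₁ x₂ y₁ y₂} → x₁ ≍ x₂ → y₁ ≍ y₂ → σ⁻¹[ x₁ ] y₁ ≍ σ⁻¹[ x₂ ] y₂
      τ-cong  : ∀ {x₁ x₂ y₁ y₂} → x₁ ≍ x₂ → y₁ ≍ y₂ → τ[ x₁ ] y₁ ≍ τ[ x₂ ] y₂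
      τ⁻¹-cong : ∀ {x₁ x₂ y₁ y₂} → x₁ ≍ x₂ → y₁ ≍ y₂ → τ⁻¹[ x₁ ] y₁ ≍ τ⁻¹[ x₂ ] y₂

{-# OPTIONS --safe #-}
module Submission where

-- 2-reductivity says that x ↦ σ_x and x ↦ τ_x both absorb σ and τ:
-- σ_{σ_x(y)} = σ_y, so σ_{σ_x(y)} depends only on y, and the same holds for the
-- inverses because σ_{σ_x⁻¹(y)} = σ_{σ_x(σ_x⁻¹(y))} = σ_y. An operation whose
-- result lies in the kernel class of its second argument respects that kernel.

open import Defs
open import Level using (Level)
open import Data.Product using (_×_; _,_)
open import Function.Bundles using (_↔_; Inverse)
open import Relation.Binary.PropositionalEquality using (_≡_; refl; sym; trans; cong; module ≡-Reasoning)
open import Relation.Binary.Structures using (IsEquivalence)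

module _ {a} {A : Set a} where

  Kernel : (A → A → A) → A → A → Set a
  Kernel f x y = ∀ z → f x z ≡ f y z

  kernel-isEquivalence : (f : A → A → A) → IsEquivalence (Kernel f)
  kernel-isEquivalence f = record
    { refl  = λ _ → refl
    ; sym   = λ p z → sym (p z)
    ; trans = λ p q z → trans (p z) (q z)
    }

  Absorbs : (A → A → A) → (A → A → A) → Set a
  Absorbs f g = ∀ x y → Kernel f (g x y) y

  absorbs⇒kernel-cong : ∀ {f g} → Absorbs f g →
    ∀ {x₁ x₂ y₁ y₂} → Kernel f y₁ y₂ → Kernel f (g x₁ y₁) (g x₂ y₂)
  absorbs⇒kernel-cong abs {x₁} {x₂} {y₁} {y₂} y₁≈y₂ z =
    trans (abs x₁ y₁ z) (trans (y₁≈y₂ z) (sym (abs x₂ y₂ z)))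

  absorbs-inverse : ∀ {f} (g : A → A ↔ A) →
    Absorbs f (λ x → Inverse.to (g x)) → Absorbs f (λ x → Inverse.from (g x))
  absorbs-inverse {f} g abs x y z = begin
    f (from y) z       ≡⟨ sym (abs x (from y) z) ⟩
    f (to (from y)) z  ≡⟨ cong (λ w → f w z) (Inverse.strictlyInverseˡ (g x) y) ⟩
    f y z              ∎
    where
    open ≡-Reasoning
    to   = Inverse.to (g x)
    from = Inverse.from (g x)

module _ {ℓ : Level} (S : Solution ℓ) where
  open Solution S

  kernel-isCongruence : (f : X → X → X) → Absorbs f σ[_] → Absorbs f τ[_] →
    IsCongruence S (Kernel f)
  kernel-isCongruence f σ-absorbs τ-absorbs = record
    { isEquivalence = kernel-isEquivalence f
    ; σ-cong   = λ _ → absorbs⇒kernel-cong σ-absorbs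
    ; σ⁻¹-cong = λ _ → absorbs⇒kernel-cong (absorbs-inverse σ σ-absorbs)
    ; τ-cong   = λ _ → absorbs⇒kernel-cong τ-absorbs
    ; τ⁻¹-cong = λ _ → absorbs⇒kernel-cong (absorbs-inverse τ τ-absorbs)
    }

proposition3p19 : {ℓ : Level} (S : Solution ℓ) → Is2Reductive S →
    IsCongruence S (_∼_ S) × IsCongruence S (_∽_ S)
proposition3p19 S (σσ , ττ , στ , τσ) =
  kernel-isCongruence S σ[_] σσ στ , kernel-isCongruence S τ[_] τσ ττ
  where open Solution S
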